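{- Let $p$ be an odd prime and let $P\in\mathbb{F}_p[x]$ be a polynomial of degree $\frac{p-1}{2}$ with $\sum_{x\in\mathbb{F}_p}P(x)=p$, where each value $P(x)$ is regarded as an integer in $\{0,1,\dots,p-1\}$ and the sum is computed in $\mathbb{Z}$. Then $P$ splits into linear factors over $\mathbb{F}_p$ and has $\frac{p-1}{2}$ distinct roots in $\mathbb{F}_p$.
   Context: Elements of $\mathbb{F}_p$ are identified with the integers $\{0,1,\dots,p-1\}$. -}

module Defs where

open import Data.Nat using (ℕ; zero; suc; _+_; _*_; _∸_; NonZero)
open import Data.Nat.DivMod using (_mod_)
open import Data.Fin using (Fin; toℕ)
open import Data.Vec using (Vec; []; _∷_; _∷ʳ_; zipWith; map; foldr)
open import Data.List using (List; allFin)
open import Data.Nat.ListAction using (sum)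
import Data.List as L

module _ (p : ℕ) .{{_ : NonZero p}} where

  zeroF : Fin p
  zeroF = 0 mod p

  oneF : Fin p
  oneF = 1 mod p

  addF : Fin p → Fin p → Fin p
  addF a b = (toℕ a + toℕ b) mod p

  subF : Fin p → Fin p → Fin p
  subF a b = (toℕ a + (p ∸ toℕ b)) mod p

  mulF : Fin p → Fin p → Fin p
  mulF a b = (toℕ a * toℕ b) mod p

  -- A polynomial of formal degree ≤ n is its coefficient vector
  -- (a₀, a₁, …, aₙ), constant term first.
  -- Evaluation by Horner's rule.
  eval : ∀ {n} → Vec (Fin p) n → Fin p → Fin p
  eval cs x = foldr _ (λ c acc → addF c (mulF x acc)) zeroF cs

  linMul : ∀ {n} → Fin p → Vec (Fin p) n → Vec (Fin p) (suc n)
  linMul r q = zipWith subF (zeroF ∷ q) (map (mulF r) q ∷ʳ zeroF)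

  prodLin : ∀ {d} → Vec (Fin p) d → Vec (Fin p) (suc d)
  prodLin [] = oneF ∷ []
  prodLin (r ∷ rs) = linMul r (prodLin rs)

  valueSum : ∀ {n} → Vec (Fin p) n → ℕ
  valueSum P = sum (L.map (λ x → toℕ (eval P x)) (allFin p))

{-# OPTIONS --safe #-}

-- Let d = (p - 1) / 2. Let M be the multiset in which every x ∈ F_p occurs P(x) times and A the
-- set F_p; both have p elements. For 0 < j < d the power sums Σ_{m∈M} m^j = Σ_x P(x) x^j and
-- Σ_x x^j vanish, as sums over F_p of polynomials of degree < p - 1. Newton's identities then make
-- the first d coefficients of ∏_{m∈M} (x - m) and ∏_{a∈A} (x - a) agree, so their difference H
-- has degree ≤ d + 1. If P has d distinct roots it is their product up to a constant. Otherwise P is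
-- nonzero at d + 2 points, all roots of both products, hence H = 0; then every point lies in M,
-- the sum condition forces P(x) = 1 for all x, and P is constant although deg P = d ≥ 1.

module Submission where

import Defs
open Defs using (zeroF; oneF; addF; subF; mulF; valueSum)
open import Algebra.Bundles using (CommutativeRing)
open import Algebra.Consequences.Propositional using (comm∧idˡ⇒id; comm∧invʳ⇒inv; comm∧distrʳ⇒distr)
open import Algebra.Core using (Op₁; Op₂)
import Algebra.Solver.Ring as Solver
open import Algebra.Solver.Ring.AlmostCommutativeRing using (AlmostCommutativeRing; fromCommutativeRing; _-Raw-AlmostCommutative⟶_)
open import Algebra.Structures using (IsCommutativeRing)
open import Data.Fin as Fin using (Fin; zero; suc; toℕ)
open import Data.Fin.Permutation using (Permutation; permutation)
open import Data.Fin.Properties using (0≢1+n; suc-injective; inject≤-injective; toℕ-fromℕ<; toℕ-injective; toℕ<n)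
open import Data.List as List using (List; []; _∷_; _++_; length)
open import Data.List.Membership.Propositional using (_∈_)
open import Data.List.Membership.Propositional.Properties using (∈-++⁺ʳ; ∈-++⁻)
import Data.List.Properties as List
open import Data.List.Relation.Unary.Any using (here; there)
import Data.Maybe as Maybe
open import Data.Nat as ℕ using (ℕ; zero; suc; NonZero; _∸_; _/_; _%_; _<_; _≤_)
open import Data.Nat.Divisibility using (_∣_; m%n≡0⇒n∣m; n∣m⇒m%n≡0)
open import Data.Nat.DivMod using (_mod_; %-distribˡ-+; %-distribˡ-*; m<n⇒m%n≡m; [m+n]%n≡m%n; m≡m%n+[m/n]*n; m%n<n; m*n/n≡m)
open import Data.Nat.Induction using (<-rec)
open import Data.Nat.ListAction using (sum)
open import Data.Nat.Primality using (Prime; euclidsLemma; prime⇒nonTrivial; ¬prime[1])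
import Data.Nat.Properties as ℕ
import Algebra.Properties.CommutativeMonoid.Sum ℕ.+-0-commutativeMonoid as ℕ-Sum
open import Data.Product using (Σ; ∃-syntax; _×_; _,_; proj₁; proj₂)
import Data.Sign as Sign
open import Data.Sum as Sum using (_⊎_; inj₁; inj₂)
open import Data.Vec using (Vec; []; _∷_; _∷ʳ_; tabulate; foldr; zipWith; map; replicate; lookup; last; init; initLast; toList)
open import Data.Vec.Properties using (∷-injectiveˡ; ∷-injectiveʳ; lookup-map; lookup∘tabulate)
open import Function using (_∘_; id)
open import Function.Definitions using (Injective)
open import Relation.Binary.PropositionalEquality
open import Relation.Binary.PropositionalEquality.Algebra using (isMagma)
open import Relation.Nullary using (¬_; contradiction)
open import Relation.Nullary.Decidable using (dec⇒maybe; toSum)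

private
  variable
    X : Set
    k : ℕ

lookup-injective-tail : ∀ {x} {xs : Vec X k} → Injective _≡_ _≡_ (lookup (x ∷ xs)) → Injective _≡_ _≡_ (lookup xs)
lookup-injective-tail inj eq = suc-injective (inj eq)

lookup-injective-head : ∀ {x} {xs : Vec X k} → Injective _≡_ _≡_ (lookup (x ∷ xs)) → ∀ i → x ≢ lookup xs i
lookup-injective-head inj i eq = 0≢1+n (inj eq)

distinct-points : ∀ {n m} → n ≤ m → Σ (Vec (Fin m) n) λ v → Injective _≡_ _≡_ (lookup v)
distinct-points n≤m = tabulate (λ i → Fin.inject≤ i n≤m) , λ {i} {j} eq →
  inject≤-injective n≤m n≤m i j (trans (sym (lookup∘tabulate _ i)) (trans eq (lookup∘tabulate _ j)))

last-∷-replicate : ∀ {n} → 0 < n → ∀ (x y : X) → last (x ∷ replicate n y) ≡ y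
last-∷-replicate {n = suc zero}    _ x y = refl
last-∷-replicate {n = suc (suc n)} _ x y = last-∷-replicate {n = suc n} (ℕ.s≤s ℕ.z≤n) y y

replicateEach : (Fin k → ℕ) → (Fin k → X) → List X
replicateEach {k = zero}  μ x = []
replicateEach {k = suc k} μ x = List.replicate (μ zero) (x zero) ++ replicateEach (μ ∘ suc) (x ∘ suc)

length-replicateEach : ∀ (μ : Fin k → ℕ) (x : Fin k → X) → length (replicateEach μ x) ≡ ℕ-Sum.sum μ
length-replicateEach {k = zero}  μ x = refl
length-replicateEach {k = suc k} μ x = trans (List.length-++ (List.replicate (μ zero) (x zero)))
  (cong₂ ℕ._+_ (List.length-replicate (μ zero)) (length-replicateEach (μ ∘ suc) (x ∘ suc)))

∈-replicateEach⁺ : ∀ (μ : Fin k → ℕ) (x : Fin k → X) i → μ i ≢ 0 → x i ∈ replicateEach μ x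
∈-replicateEach⁺ μ x zero    μᵢ≢0 with μ zero
... | zero  = contradiction refl μᵢ≢0
... | suc _ = here refl
∈-replicateEach⁺ μ x (suc i) μᵢ≢0 =
  ∈-++⁺ʳ (List.replicate (μ zero) (x zero)) (∈-replicateEach⁺ (μ ∘ suc) (x ∘ suc) i μᵢ≢0)

∈-replicateEach⁻ : ∀ (μ : Fin k → ℕ) (x : Fin k → X) {y} → y ∈ replicateEach μ x → ∃[ i ] μ i ≢ 0 × y ≡ x i
∈-replicateEach⁻ {k = suc k} μ x y∈ with ∈-++⁻ (List.replicate (μ zero) (x zero)) y∈
... | inj₂ y∈rest =
  let i , μᵢ≢0 , y≡xᵢ = ∈-replicateEach⁻ (μ ∘ suc) (x ∘ suc) y∈rest in suc i , μᵢ≢0 , y≡xᵢ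
... | inj₁ y∈replicate = zero , ∈-replicate⁻ (μ zero) y∈replicate
  where
  ∈-replicate⁻ : ∀ m {y z : X} → y ∈ List.replicate m z → m ≢ 0 × y ≡ z
  ∈-replicate⁻ (suc m) (here y≡z)  = (λ ()) , y≡z
  ∈-replicate⁻ (suc m) (there y∈)  = (λ ()) , proj₂ (∈-replicate⁻ m y∈)

n≤sum : ∀ {n} (μ : Fin n → ℕ) → (∀ i → μ i ≢ 0) → n ≤ ℕ-Sum.sum μ
n≤sum {zero}  μ μ≢0 = ℕ.z≤n
n≤sum {suc n} μ μ≢0 = ℕ.+-mono-≤ (ℕ.n≢0⇒n>0 (μ≢0 zero)) (n≤sum (μ ∘ suc) (μ≢0 ∘ suc))

sum≡n⇒all-one : ∀ {n} (μ : Fin n → ℕ) → (∀ i → μ i ≢ 0) → ℕ-Sum.sum μ ≡ n → ∀ i → μ i ≡ 1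
sum≡n⇒all-one {suc n} μ μ≢0 sum≡1+n = λ where
    zero    → μ₀≡1
    (suc i) → sum≡n⇒all-one (μ ∘ suc) (μ≢0 ∘ suc) tail≡n i
  where
  μ₀≤1 : μ zero ≤ 1
  μ₀≤1 = ℕ.+-cancelʳ-≤ n (μ zero) 1
           (ℕ.≤-trans (ℕ.+-monoʳ-≤ (μ zero) (n≤sum (μ ∘ suc) (μ≢0 ∘ suc))) (ℕ.≤-reflexive sum≡1+n))
  μ₀≡1 : μ zero ≡ 1
  μ₀≡1 = ℕ.≤-antisym μ₀≤1 (ℕ.n≢0⇒n>0 (μ≢0 zero))
  tail≡n : ℕ-Sum.sum (μ ∘ suc) ≡ n
  tail≡n = ℕ.suc-injective (trans (cong (ℕ._+ ℕ-Sum.sum (μ ∘ suc)) (sym μ₀≡1)) sum≡1+n)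

sum-allFin : ∀ n (f : Fin n → ℕ) → sum (List.map f (List.allFin n)) ≡ ℕ-Sum.sum f
sum-allFin n f = trans (cong sum (List.map-tabulate id f)) (sum-tabulate n f)
  where
  sum-tabulate : ∀ n (f : Fin n → ℕ) → sum (List.tabulate f) ≡ ℕ-Sum.sum f
  sum-tabulate zero    f = refl
  sum-tabulate (suc n) f = cong (f zero ℕ.+_) (sum-tabulate n (f ∘ suc))

sum-ones : ∀ n → ℕ-Sum.sum {n} (λ _ → 1) ≡ n
sum-ones zero    = refl
sum-ones (suc n) = cong suc (sum-ones n)

DistinctPoints : ∀ {n} → (Fin n → Set) → ℕ → Set
DistinctPoints {n} P k = Σ (Vec (Fin n) k) λ v → Injective _≡_ _≡_ (lookup v) × (∀ i → P (lookup v i))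

private
  none : ∀ {n} {P : Fin n → Set} → DistinctPoints P 0
  none = [] , (λ { {()} }) , λ ()

  lookup-map-suc : ∀ {n} (v : Vec (Fin n) k) i → lookup (map suc v) i ≡ suc (lookup v i)
  lookup-map-suc v i = lookup-map i Fin.suc v

  lift : ∀ {n} {R : Fin (suc n) → Set} → DistinctPoints (R ∘ suc) k → DistinctPoints R k
  lift {R = R} (v , inj , Rv) =
    map suc v ,
    (λ {i} {j} eq → inj (suc-injective (trans (sym (lookup-map-suc v i)) (trans eq (lookup-map-suc v j))))) ,
    (λ i → subst R (sym (lookup-map-suc v i)) (Rv i))

  cons : ∀ {n} {P : Fin (suc n) → Set} → P zero → DistinctPoints (P ∘ suc) k → DistinctPoints P (suc k)
  cons {k = k} {P = P} P₀ d@(v , _ , _) = zero ∷ map suc v , inj′ , λ { zero → P₀ ; (suc i) → proj₂ (proj₂ lifted) i }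
    where
    lifted : DistinctPoints P k
    lifted = lift {R = P} d
    inj′ : Injective _≡_ _≡_ (lookup (zero ∷ map suc v))
    inj′ {zero}  {zero}  _  = refl
    inj′ {zero}  {suc j} eq = contradiction (trans eq (lookup-map-suc v j)) 0≢1+n
    inj′ {suc i} {zero}  eq = contradiction (trans (sym eq) (lookup-map-suc v i)) 0≢1+n
    inj′ {suc i} {suc j} eq = cong suc (proj₁ (proj₂ lifted) eq)

  extend : ∀ {n} {P R : Fin (suc n) → Set} → P zero →
           (∀ a b → a ℕ.+ b ≡ suc n → DistinctPoints (P ∘ suc) a ⊎ DistinctPoints (R ∘ suc) b) →
           ∀ a b → a ℕ.+ b ≡ suc (suc n) → DistinctPoints P a ⊎ DistinctPoints R b
  extend {P = P} P₀ rec zero b _ = inj₁ (none {P = P})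
  extend {P = P} {R = R} P₀ rec (suc a) b eq = Sum.map (cons {P = P} P₀) (lift {R = R}) (rec a b (ℕ.suc-injective eq))

pigeonhole : ∀ {n} {P R : Fin n → Set} → (∀ x → P x ⊎ R x) →
             ∀ a b → a ℕ.+ b ≡ suc n → DistinctPoints P a ⊎ DistinctPoints R b
pigeonhole {zero} {P}     _ zero    _       _  = inj₁ (none {P = P})
pigeonhole {zero} {R = R} _ (suc _) zero    _  = inj₂ (none {P = R})
pigeonhole {zero}         _ (suc a) (suc b) eq = contradiction (ℕ.suc-injective eq) (ℕ.m+1+n≢0 a)
pigeonhole {suc n} {P} {R} cover a b eq with cover zero
... | inj₁ P₀ = extend {P = P} {R = R} P₀ (pigeonhole (cover ∘ suc)) a b eq
... | inj₂ R₀ = Sum.swap (extend {P = R} {R = P} R₀ swapped b a (trans (ℕ.+-comm b a) eq))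
  where
  swapped : ∀ b a → b ℕ.+ a ≡ suc n → DistinctPoints (R ∘ suc) b ⊎ DistinctPoints (P ∘ suc) a
  swapped b a b+a≡1+n = Sum.swap (pigeonhole (cover ∘ suc) a b (trans (ℕ.+-comm a b) b+a≡1+n))

module Polynomials {A : Set} {add mul : Op₂ A} {neg : Op₁ A} {0ᴬ 1ᴬ : A}
                   (isCommutativeRing : IsCommutativeRing _≡_ add mul neg 0ᴬ 1ᴬ) where

  commutativeRing : CommutativeRing _ _
  commutativeRing = record { isCommutativeRing = isCommutativeRing }

  open CommutativeRing commutativeRing public using (_+_; _*_; -_; _-_; 0#; 1#)
  open CommutativeRing commutativeRing
    using ( +-identityˡ; +-identityʳ; zeroˡ; zeroʳ; +-assoc; +-comm; -‿inverseʳ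
          ; +-group; +-abelianGroup; +-commutativeSemigroup; semiring; ring; rawRing )
  open import Algebra.Properties.Semiring.Exp semiring public using (_^_)
  open import Algebra.Properties.Semiring.Sum semiring public using (sum-syntax)
  open import Algebra.Properties.Semiring.Mult.TCOptimised semiring as Mult using (1+×; ×-homo-+; ×1-homo-*)
  open import Algebra.Properties.Ring ring using (x[y-z]≈xy-xz; -‿distribˡ-*; -‿distribʳ-*; -‿involutive)
  open import Algebra.Properties.Group +-group using (x∙y⁻¹≈ε⇒x≈y; ε⁻¹≈ε; inverseˡ-unique)
  open import Algebra.Properties.AbelianGroup +-abelianGroup using (⁻¹-∙-comm)
  open import Algebra.Properties.CommutativeSemigroup +-commutativeSemigroup using (interchange)

  fromℕ : ℕ → A
  fromℕ n = n Mult.× 1#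

  fromℕ-suc : ∀ n → fromℕ (suc n) ≡ 1# + fromℕ n
  fromℕ-suc n = 1+× n 1#

  -- The ring solver needs integer coefficients, interpreted through the initial map ℤ → A.
  module _ where
    open import Data.Integer as ℤ using (ℤ; -[1+_]; _⊖_)
    import Data.Integer.Properties as ℤ

    fromℤ : ℤ → A
    fromℤ (ℤ.+ n)  = fromℕ n
    fromℤ -[1+ n ] = - fromℕ (suc n)

    fromℤ-⊖ : ∀ m n → fromℤ (m ⊖ n) ≡ fromℕ m - fromℕ n
    fromℤ-⊖ m       zero    = sym (trans (cong (fromℕ m +_) ε⁻¹≈ε) (+-identityʳ _))
    fromℤ-⊖ zero    (suc n) = sym (+-identityˡ _)
    fromℤ-⊖ (suc m) (suc n) = begin
      fromℤ (suc m ⊖ suc n)                ≡⟨ cong fromℤ (ℤ.[1+m]⊖[1+n]≡m⊖n m n) ⟩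
      fromℤ (m ⊖ n)                        ≡⟨ fromℤ-⊖ m n ⟩
      fromℕ m - fromℕ n                    ≡⟨ +-identityˡ _ ⟨
      0# + (fromℕ m - fromℕ n)             ≡⟨ cong (_+ (fromℕ m - fromℕ n)) (-‿inverseʳ 1#) ⟨
      (1# - 1#) + (fromℕ m - fromℕ n)      ≡⟨ interchange 1# (- 1#) (fromℕ m) (- fromℕ n) ⟩
      (1# + fromℕ m) + (- 1# - fromℕ n)    ≡⟨ cong ((1# + fromℕ m) +_) (⁻¹-∙-comm 1# (fromℕ n)) ⟩
      (1# + fromℕ m) - (1# + fromℕ n)      ≡⟨ cong₂ _-_ (fromℕ-suc m) (fromℕ-suc n) ⟨
      fromℕ (suc m) - fromℕ (suc n)        ∎
      where open ≡-Reasoning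

    fromℤ-homo-+ : ∀ i j → fromℤ (i ℤ.+ j) ≡ fromℤ i + fromℤ j
    fromℤ-homo-+ (ℤ.+ m)  (ℤ.+ n)  = ×-homo-+ 1# m n
    fromℤ-homo-+ (ℤ.+ m)  -[1+ n ] = fromℤ-⊖ m (suc n)
    fromℤ-homo-+ -[1+ m ] (ℤ.+ n)  = trans (fromℤ-⊖ n (suc m)) (+-comm _ _)
    fromℤ-homo-+ -[1+ m ] -[1+ n ] = begin
      - fromℕ (suc (suc (m ℕ.+ n)))        ≡⟨ cong (λ k → - fromℕ (suc k)) (ℕ.+-suc m n) ⟨
      - fromℕ (suc m ℕ.+ suc n)            ≡⟨ cong -_ (×-homo-+ 1# (suc m) (suc n)) ⟩
      - (fromℕ (suc m) + fromℕ (suc n))    ≡⟨ ⁻¹-∙-comm _ _ ⟨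
      - fromℕ (suc m) + - fromℕ (suc n)    ∎
      where open ≡-Reasoning

    private
      fromℤ-pos◃ : ∀ n → fromℤ (Sign.+ ℤ.◃ n) ≡ fromℕ n
      fromℤ-pos◃ zero    = refl
      fromℤ-pos◃ (suc n) = refl

      fromℤ-neg◃ : ∀ n → fromℤ (Sign.- ℤ.◃ n) ≡ - fromℕ n
      fromℤ-neg◃ zero    = sym ε⁻¹≈ε
      fromℤ-neg◃ (suc n) = refl

    fromℤ-homo-* : ∀ i j → fromℤ (i ℤ.* j) ≡ fromℤ i * fromℤ j
    fromℤ-homo-* (ℤ.+ m)  (ℤ.+ n)  = trans (fromℤ-pos◃ (m ℕ.* n)) (×1-homo-* m n)
    fromℤ-homo-* (ℤ.+ m)  -[1+ n ] =
      trans (fromℤ-neg◃ (m ℕ.* suc n)) (trans (cong -_ (×1-homo-* m (suc n))) (-‿distribʳ-* _ _))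
    fromℤ-homo-* -[1+ m ] (ℤ.+ n)  =
      trans (fromℤ-neg◃ (suc m ℕ.* n)) (trans (cong -_ (×1-homo-* (suc m) n)) (-‿distribˡ-* _ _))
    fromℤ-homo-* -[1+ m ] -[1+ n ] = begin
      fromℕ (suc m ℕ.* suc n)              ≡⟨ ×1-homo-* (suc m) (suc n) ⟩
      a * b                                ≡⟨ -‿involutive (a * b) ⟨
      - - (a * b)                          ≡⟨ cong -_ (-‿distribˡ-* a b) ⟩
      - (- a * b)                          ≡⟨ -‿distribʳ-* (- a) b ⟩
      - a * - b                            ∎
      where
      open ≡-Reasoning
      a b : A
      a = fromℕ (suc m)
      b = fromℕ (suc n)

    fromℤ-homo-neg : ∀ i → fromℤ (ℤ.- i) ≡ - fromℤ i
    fromℤ-homo-neg (ℤ.+ zero)    = sym ε⁻¹≈ε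
    fromℤ-homo-neg (ℤ.+ (suc n)) = refl
    fromℤ-homo-neg -[1+ n ]      = sym (-‿involutive _)

    private
      almostRing : AlmostCommutativeRing _ _
      almostRing = fromCommutativeRing commutativeRing

      ℤ-homomorphism : ℤ.+-*-rawRing -Raw-AlmostCommutative⟶ almostRing
      ℤ-homomorphism = record
        { ⟦_⟧    = fromℤ
        ; +-homo = fromℤ-homo-+
        ; *-homo = fromℤ-homo-*
        ; -‿homo = fromℤ-homo-neg
        ; 0-homo = refl
        ; 1-homo = refl
        }

    open Solver ℤ.+-*-rawRing almostRing ℤ-homomorphism
                (λ i j → Maybe.map (cong fromℤ) (dec⇒maybe (i ℤ.≟ j)))
      public using (solve; Polynomial; _:+_; _:*_; _:-_; con; _:=_)

    :0 :1 : ∀ {n} → Polynomial n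
    :0 = con (ℤ.+ 0)
    :1 = con (ℤ.+ 1)

  private
    variable
      m n : ℕ

  eval : Vec A n → A → A
  eval cs x = foldr _ (λ c acc → c + x * acc) 0# cs

  linMul : A → Vec A n → Vec A (suc n)
  linMul r q = zipWith _-_ (0# ∷ q) (map (r *_) q ∷ʳ 0#)

  prodLin : Vec A m → Vec A (suc m)
  prodLin [] = 1# ∷ []
  prodLin (r ∷ rs) = linMul r (prodLin rs)

  rootProduct : List A → A → A
  rootProduct [] x = 1#
  rootProduct (r ∷ rs) x = (x - r) * rootProduct rs x

  eval-linMul : ∀ r (q : Vec A n) x → eval (linMul r q) x ≡ (x - r) * eval q x
  eval-linMul r q x = trans (shifted 0# q) (+-identityˡ _)
    where
    shifted : ∀ {n} b (q : Vec A n) →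
              eval (zipWith _-_ (b ∷ q) (map (r *_) q ∷ʳ 0#)) x ≡ b + (x - r) * eval q x
    shifted b [] = solve 3 (λ b x r → (b :- :0) :+ x :* :0 := b :+ (x :- r) :* :0) refl b x r
    shifted b (a ∷ q) = begin
      (b - r * a) + x * eval (zipWith _-_ (a ∷ q) (map (r *_) q ∷ʳ 0#)) x
        ≡⟨ cong (λ e → (b - r * a) + x * e) (shifted a q) ⟩
      (b - r * a) + x * (a + (x - r) * eval q x)
        ≡⟨ solve 5 (λ b r a x e → (b :- r :* a) :+ x :* (a :+ (x :- r) :* e)
                                  := b :+ (x :- r) :* (a :+ x :* e)) refl b r a x (eval q x) ⟩
      b + (x - r) * (a + x * eval q x) ∎
      where open ≡-Reasoning

  eval-prodLin : ∀ (rs : Vec A m) x → eval (prodLin rs) x ≡ rootProduct (toList rs) x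
  eval-prodLin [] x = solve 1 (λ x → :1 :+ x :* :0 := :1) refl x
  eval-prodLin (r ∷ rs) x = trans (eval-linMul r (prodLin rs) x) (cong ((x - r) *_) (eval-prodLin rs x))

  eval-map-* : ∀ c (q : Vec A n) x → eval (map (c *_) q) x ≡ c * eval q x
  eval-map-* c [] x = solve 1 (λ c → :0 := c :* :0) refl c
  eval-map-* c (a ∷ q) x = begin
    c * a + x * eval (map (c *_) q) x
      ≡⟨ cong (λ e → c * a + x * e) (eval-map-* c q x) ⟩
    c * a + x * (c * eval q x)
      ≡⟨ solve 4 (λ c a x e → c :* a :+ x :* (c :* e) := c :* (a :+ x :* e)) refl c a x (eval q x) ⟩
    c * (a + x * eval q x) ∎
    where open ≡-Reasoning

  eval-zipWith-add : ∀ (P Q : Vec A n) x → eval (zipWith _+_ P Q) x ≡ eval P x + eval Q x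
  eval-zipWith-add [] [] x = solve 0 (:0 := :0 :+ :0) refl
  eval-zipWith-add (a ∷ P) (b ∷ Q) x = begin
    (a + b) + x * eval (zipWith _+_ P Q) x
      ≡⟨ cong (λ e → (a + b) + x * e) (eval-zipWith-add P Q x) ⟩
    (a + b) + x * (eval P x + eval Q x)
      ≡⟨ solve 5 (λ a b x u v → (a :+ b) :+ x :* (u :+ v)
                                := (a :+ x :* u) :+ (b :+ x :* v)) refl a b x (eval P x) (eval Q x) ⟩
    (a + x * eval P x) + (b + x * eval Q x) ∎
    where open ≡-Reasoning

  eval-zipWith-sub : ∀ (P Q : Vec A n) x → eval (zipWith _-_ P Q) x ≡ eval P x - eval Q x
  eval-zipWith-sub [] [] x = solve 0 (:0 := :0 :- :0) refl
  eval-zipWith-sub (a ∷ P) (b ∷ Q) x = begin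
    (a - b) + x * eval (zipWith _-_ P Q) x
      ≡⟨ cong (λ e → (a - b) + x * e) (eval-zipWith-sub P Q x) ⟩
    (a - b) + x * (eval P x - eval Q x)
      ≡⟨ solve 5 (λ a b x u v → (a :- b) :+ x :* (u :- v)
                                := (a :+ x :* u) :- (b :+ x :* v)) refl a b x (eval P x) (eval Q x) ⟩
    (a + x * eval P x) - (b + x * eval Q x) ∎
    where open ≡-Reasoning

  eval-∷ʳ : ∀ (q : Vec A n) c x → eval (q ∷ʳ c) x ≡ eval q x + c * x ^ n
  eval-∷ʳ [] c x = solve 2 (λ c x → c :+ x :* :0 := :0 :+ c :* :1) refl c x
  eval-∷ʳ {suc n} (a ∷ q) c x = begin
    a + x * eval (q ∷ʳ c) x
      ≡⟨ cong (λ e → a + x * e) (eval-∷ʳ q c x) ⟩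
    a + x * (eval q x + c * x ^ n)
      ≡⟨ solve 5 (λ a x e c w → a :+ x :* (e :+ c :* w)
                                := (a :+ x :* e) :+ c :* (x :* w)) refl a x (eval q x) c (x ^ n) ⟩
    (a + x * eval q x) + c * x ^ suc n ∎
    where open ≡-Reasoning

  eval-replicate-0# : ∀ n x → eval (replicate n 0#) x ≡ 0#
  eval-replicate-0# zero x = refl
  eval-replicate-0# (suc n) x = trans (cong (λ e → 0# + x * e) (eval-replicate-0# n x)) (solve 1 (λ x → :0 :+ x :* :0 := :0) refl x)

  quot : A → Vec A (suc n) → Vec A n
  quot r (a ∷ []) = []
  quot r (a ∷ b ∷ q) = eval (b ∷ q) r ∷ quot r (b ∷ q)

  remainder-theorem : ∀ r (P : Vec A (suc n)) x → eval P x ≡ (x - r) * eval (quot r P) x + eval P r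
  remainder-theorem r (a ∷ []) x = solve 3 (λ a x r → a :+ x :* :0 := (x :- r) :* :0 :+ (a :+ r :* :0)) refl a x r
  remainder-theorem r (a ∷ b ∷ q) x = begin
    a + x * eval (b ∷ q) x
      ≡⟨ cong (λ e → a + x * e) (remainder-theorem r (b ∷ q) x) ⟩
    a + x * ((x - r) * Q + ρ)
      ≡⟨ solve 5 (λ a x r Q ρ → a :+ x :* ((x :- r) :* Q :+ ρ)
                                := (x :- r) :* (ρ :+ x :* Q) :+ (a :+ r :* ρ)) refl a x r Q ρ ⟩
    (x - r) * (ρ + x * Q) + (a + r * ρ) ∎
    where
    open ≡-Reasoning
    Q ρ : A
    Q = eval (quot r (b ∷ q)) x
    ρ = eval (b ∷ q) r

  last-quot : ∀ r (P : Vec A (suc (suc n))) → last (quot r P) ≡ last P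
  last-quot r (a ∷ b ∷ []) = solve 2 (λ b r → b :+ r :* :0 := b) refl b r
  last-quot r (a ∷ b ∷ c ∷ q) = last-quot r (b ∷ c ∷ q)

  binomialTail : ∀ k → Vec A k
  binomialTail zero    = []
  binomialTail (suc k) = zipWith _+_ (binomialTail k ∷ʳ fromℕ (suc k)) (0# ∷ binomialTail k)

  eval-binomialTail : ∀ k x → eval (binomialTail k) x ≡ (x + 1#) ^ suc k - x ^ suc k - fromℕ (suc k) * x ^ k
  eval-binomialTail zero x = solve 1 (λ x → :0 := (x :+ :1) :* :1 :- x :* :1 :- :1 :* :1) refl x
  eval-binomialTail (suc k) x = begin
    eval (zipWith _+_ (R ∷ʳ c′) (0# ∷ R)) x
      ≡⟨ eval-zipWith-add (R ∷ʳ c′) (0# ∷ R) x ⟩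
    eval (R ∷ʳ c′) x + (0# + x * eval R x)
      ≡⟨ cong (_+ (0# + x * eval R x)) (eval-∷ʳ R c′ x) ⟩
    eval R x + c′ * x ^ k + (0# + x * eval R x)
      ≡⟨ cong (λ r → r + c′ * x ^ k + (0# + x * r)) (eval-binomialTail k x) ⟩
    (B - x * w - c′ * w) + c′ * w + (0# + x * (B - x * w - c′ * w))
      ≡⟨ solve 4 (λ x B w c → (B :- x :* w :- c :* w) :+ c :* w :+ (:0 :+ x :* (B :- x :* w :- c :* w))
                              := (x :+ :1) :* B :- x :* (x :* w) :- (:1 :+ c) :* (x :* w)) refl x B w c′ ⟩
    (x + 1#) * B - x * (x * w) - (1# + c′) * (x * w)
      ≡⟨ cong (λ c → (x + 1#) * B - x * (x * w) - c * (x * w)) (fromℕ-suc (suc k)) ⟨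
    (x + 1#) ^ suc (suc k) - x ^ suc (suc k) - fromℕ (suc (suc k)) * x ^ suc k ∎
    where
    open ≡-Reasoning
    R : Vec A k
    R = binomialTail k
    c′ B w : A
    c′ = fromℕ (suc k)
    B  = (x + 1#) ^ suc k
    w  = x ^ k

  ∈⇒rootProduct≡0# : ∀ {y} {rs : List A} → y ∈ rs → rootProduct rs y ≡ 0#
  ∈⇒rootProduct≡0# {y} {r ∷ rs} (here refl) = trans (cong (_* rootProduct rs y) (-‿inverseʳ y)) (zeroˡ _)
  ∈⇒rootProduct≡0# {y} {r ∷ rs} (there y∈rs) = trans (cong ((y - r) *_) (∈⇒rootProduct≡0# y∈rs)) (zeroʳ _)

  powerSum : ℕ → List A → A
  powerSum j []      = 0#
  powerSum j (m ∷ M) = m ^ j + powerSum j M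

  shift : (ℕ → A) → ℕ → A
  shift f zero    = 0#
  shift f (suc i) = f i

  linMulDesc : A → (ℕ → A) → ℕ → A
  linMulDesc m f i = f i - m * shift f i

  -- coeff M k is the coefficient of x ^ (length M ∸ k) in rootProduct M x, i.e. (-1)^k e_k(M).
  coeff : List A → ℕ → A
  coeff []      zero    = 1#
  coeff []      (suc k) = 0#
  coeff (m ∷ M) k       = linMulDesc m (coeff M) k

  coeff-zero : ∀ M → coeff M 0 ≡ 1#
  coeff-zero []      = refl
  coeff-zero (m ∷ M) = trans (cong (λ e → e - m * 0#) (coeff-zero M)) (solve 1 (λ m → :1 :- m :* :0 := :1) refl m)

  coeff-beyond : ∀ M k → length M < k → coeff M k ≡ 0#
  coeff-beyond []      (suc k) _ = refl
  coeff-beyond (m ∷ M) (suc k) (ℕ.s≤s |M|<k) =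
    trans (cong₂ (λ e e′ → e - m * e′) (coeff-beyond M (suc k) (ℕ.m<n⇒m<1+n |M|<k)) (coeff-beyond M k |M|<k))
          (solve 1 (λ m → :0 :- m :* :0 := :0) refl m)

  convolution : (ℕ → A) → (ℕ → A) → ℕ → A
  convolution f g zero    = 0#
  convolution f g (suc k) = f 0 * g (suc k) + convolution (f ∘ suc) g k

  convolution-cong : ∀ k {f f′ g g′ : ℕ → A} →
                     (∀ i → i < k → f i ≡ f′ i) → (∀ j → 0 < j → j ≤ k → g j ≡ g′ j) →
                     convolution f g k ≡ convolution f′ g′ k
  convolution-cong zero    f≗f′ g≗g′ = refl
  convolution-cong (suc k) f≗f′ g≗g′ = cong₂ _+_
    (cong₂ _*_ (f≗f′ 0 (ℕ.s≤s ℕ.z≤n)) (g≗g′ (suc k) (ℕ.s≤s ℕ.z≤n) ℕ.≤-refl))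
    (convolution-cong k (λ i i<k → f≗f′ (suc i) (ℕ.s≤s i<k)) (λ j 0<j j≤k → g≗g′ j 0<j (ℕ.m≤n⇒m≤1+n j≤k)))

  convolution-zeroʳ : ∀ k f → convolution f (λ _ → 0#) k ≡ 0#
  convolution-zeroʳ zero    f = refl
  convolution-zeroʳ (suc k) f = trans (cong₂ _+_ (zeroʳ (f 0)) (convolution-zeroʳ k (f ∘ suc))) (+-identityˡ 0#)

  convolution-+ʳ : ∀ k f g g′ → convolution f (λ j → g j + g′ j) k ≡ convolution f g k + convolution f g′ k
  convolution-+ʳ zero    f g g′ = sym (+-identityˡ 0#)
  convolution-+ʳ (suc k) f g g′ =
    trans (cong (f 0 * (g (suc k) + g′ (suc k)) +_) (convolution-+ʳ k (f ∘ suc) g g′))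
          (solve 5 (λ a b c u v → a :* (b :+ c) :+ (u :+ v) := (a :* b :+ u) :+ (a :* c :+ v)) refl
                   (f 0) (g (suc k)) (g′ (suc k)) _ _)

  convolution-linearˡ : ∀ k f h g m → convolution (λ i → f i - m * h i) g k ≡ convolution f g k - m * convolution h g k
  convolution-linearˡ zero    f h g m = solve 1 (λ m → :0 := :0 :- m :* :0) refl m
  convolution-linearˡ (suc k) f h g m =
    trans (cong ((f 0 - m * h 0) * g (suc k) +_) (convolution-linearˡ k (f ∘ suc) (h ∘ suc) g m))
          (solve 6 (λ a b c m u v → (a :- m :* b) :* c :+ (u :- m :* v) := (a :* c :+ u) :- m :* (b :* c :+ v)) refl
                   (f 0) (h 0) (g (suc k)) m _ _)

  convolution-shiftˡ : ∀ k f g → convolution (shift f) g (suc k) ≡ convolution f g k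
  convolution-shiftˡ k f g = trans (cong (_+ convolution f g k) (zeroˡ _)) (+-identityˡ _)

  convolution-powers : ∀ k f m → convolution f (m ^_) (suc k) ≡ m * (convolution f (m ^_) k + f k)
  convolution-powers zero    f m = solve 2 (λ a m → a :* (m :* :1) :+ :0 := m :* (:0 :+ a)) refl (f 0) m
  convolution-powers (suc k) f m = begin
    f 0 * (m * m ^ suc k) + convolution (f ∘ suc) (m ^_) (suc k)
      ≡⟨ cong (f 0 * (m * m ^ suc k) +_) (convolution-powers k (f ∘ suc) m) ⟩
    f 0 * (m * m ^ suc k) + m * (convolution (f ∘ suc) (m ^_) k + f (suc k))
      ≡⟨ solve 5 (λ a m w c b → a :* (m :* w) :+ m :* (c :+ b)
                                := m :* ((a :* w :+ c) :+ b)) refl (f 0) m (m ^ suc k) _ (f (suc k)) ⟩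
    m * ((f 0 * m ^ suc k + convolution (f ∘ suc) (m ^_) k) + f (suc k)) ∎
    where open ≡-Reasoning

  convolution-telescopes : ∀ k f m → convolution (linMulDesc m f) (m ^_) (suc k) ≡ m * f k
  convolution-telescopes zero f m =
    trans (convolution-powers zero (linMulDesc m f) m) (solve 2 (λ m a → m :* (:0 :+ (a :- m :* :0)) := m :* a) refl m (f 0))
  convolution-telescopes (suc k) f m = begin
    convolution f′ (m ^_) (suc (suc k))
      ≡⟨ convolution-powers (suc k) f′ m ⟩
    m * (convolution f′ (m ^_) (suc k) + f′ (suc k))
      ≡⟨ cong (λ c → m * (c + f′ (suc k))) (convolution-telescopes k f m) ⟩
    m * (m * f k + (f (suc k) - m * f k))
      ≡⟨ solve 3 (λ m a b → m :* (m :* a :+ (b :- m :* a)) := m :* b) refl m (f k) (f (suc k)) ⟩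
    m * f (suc k) ∎
    where
    open ≡-Reasoning
    f′ : ℕ → A
    f′ = linMulDesc m f

  newton-identity : ∀ M k → fromℕ k * coeff M k + convolution (coeff M) (λ j → powerSum j M) k ≡ 0#
  newton-identity []      zero    = solve 0 (:0 :* :1 :+ :0 := :0) refl
  newton-identity []      (suc k) = trans (cong₂ _+_ (zeroʳ _) (convolution-zeroʳ (suc k) (coeff []))) (+-identityˡ 0#)
  newton-identity (m ∷ M) zero    = trans (+-identityʳ _) (zeroˡ _)
  newton-identity (m ∷ M) (suc k) = begin
    (fromℕ (suc k)) * E′ (suc k) + convolution E′ (λ j → m ^ j + powerSum j M) (suc k)
      ≡⟨ cong₂ _+_ (cong (_* E′ (suc k)) (fromℕ-suc k)) (convolution-+ʳ (suc k) E′ (m ^_) (λ j → powerSum j M)) ⟩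
    (1# + c) * E′ (suc k) + (convolution E′ (m ^_) (suc k) + convolution E′ p (suc k))
      ≡⟨ cong (λ t → (1# + c) * E′ (suc k) + t) (cong₂ _+_ (convolution-telescopes k E m)
           (trans (convolution-linearˡ (suc k) E (shift E) p m)
                  (cong (λ t → convolution E p (suc k) - m * t) (convolution-shiftˡ k E p)))) ⟩
    (1# + c) * (E (suc k) - m * E k) + (m * E k + (convolution E p (suc k) - m * convolution E p k))
      ≡⟨ solve 6 (λ c b a m u v → (:1 :+ c) :* (b :- m :* a) :+ (m :* a :+ (u :- m :* v))
                                  := ((:1 :+ c) :* b :+ u) :- m :* (c :* a :+ v)) refl
               c (E (suc k)) (E k) m (convolution E p (suc k)) (convolution E p k) ⟩
    ((1# + c) * E (suc k) + convolution E p (suc k)) - m * (c * E k + convolution E p k)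
      ≡⟨ cong₂ (λ u v → u - m * v)
               (trans (cong (λ t → t * E (suc k) + convolution E p (suc k)) (sym (fromℕ-suc k))) (newton-identity M (suc k)))
               (newton-identity M k) ⟩
    0# - m * 0#
      ≡⟨ solve 1 (λ m → :0 :- m :* :0 := :0) refl m ⟩
    0# ∎
    where
    open ≡-Reasoning
    E E′ p : ℕ → A
    E  = coeff M
    E′ = coeff (m ∷ M)
    p  = λ j → powerSum j M
    c : A
    c  = fromℕ k

  powerSum-replicateEach : ∀ j (μ : Fin k → ℕ) (x : Fin k → A) →
                           powerSum j (replicateEach μ x) ≡ ∑[ i < k ] (fromℕ (μ i) * x i ^ j)
  powerSum-replicateEach {k = zero}  j μ x = refl
  powerSum-replicateEach {k = suc k} j μ x = begin
    powerSum j (List.replicate (μ zero) (x zero) ++ replicateEach (μ ∘ suc) (x ∘ suc))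
      ≡⟨ powerSum-++ (List.replicate (μ zero) (x zero)) _ ⟩
    powerSum j (List.replicate (μ zero) (x zero)) + powerSum j (replicateEach (μ ∘ suc) (x ∘ suc))
      ≡⟨ cong₂ _+_ (powerSum-replicate (μ zero)) (powerSum-replicateEach j (μ ∘ suc) (x ∘ suc)) ⟩
    fromℕ (μ zero) * x zero ^ j + ∑[ i < k ] (fromℕ (μ (suc i)) * x (suc i) ^ j) ∎
    where
    open ≡-Reasoning
    powerSum-++ : ∀ xs ys → powerSum j (xs ++ ys) ≡ powerSum j xs + powerSum j ys
    powerSum-++ []       ys = sym (+-identityˡ _)
    powerSum-++ (x ∷ xs) ys = trans (cong (x ^ j +_) (powerSum-++ xs ys)) (sym (+-assoc _ _ _))
    powerSum-replicate : ∀ m {y} → powerSum j (List.replicate m y) ≡ fromℕ m * y ^ j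
    powerSum-replicate zero    {y} = sym (zeroˡ _)
    powerSum-replicate (suc m) {y} = begin
      y ^ j + powerSum j (List.replicate m y)
        ≡⟨ cong (y ^ j +_) (powerSum-replicate m) ⟩
      y ^ j + fromℕ m * y ^ j
        ≡⟨ solve 2 (λ w c → w :+ c :* w := (:1 :+ c) :* w) refl (y ^ j) (fromℕ m) ⟩
      (1# + fromℕ m) * y ^ j
        ≡⟨ cong (_* y ^ j) (fromℕ-suc m) ⟨
      fromℕ (suc m) * y ^ j ∎

  coeff-determined-by-powerSums : ∀ {K} (M N : List A) →
    (∀ {k x} → 0 < k → k < K → fromℕ k * x ≡ 0# → x ≡ 0#) →
    (∀ j → 0 < j → j < K → powerSum j M ≡ powerSum j N) →
    ∀ k → k < K → coeff M k ≡ coeff N k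
  coeff-determined-by-powerSums {K} M N regular same-powerSums = <-rec _ step
    where
    step : ∀ k → (∀ {i} → i < k → i < K → coeff M i ≡ coeff N i) → k < K → coeff M k ≡ coeff N k
    step zero    _   _   = trans (coeff-zero M) (sym (coeff-zero N))
    step (suc k) rec k<K = x∙y⁻¹≈ε⇒x≈y _ _ (regular (ℕ.s≤s ℕ.z≤n) k<K (begin
      c * (coeff M (suc k) - coeff N (suc k))          ≡⟨ x[y-z]≈xy-xz c _ _ ⟩
      c * coeff M (suc k) - c * coeff N (suc k)        ≡⟨ cong (_- c * coeff N (suc k)) c*coeffs-agree ⟩
      c * coeff N (suc k) - c * coeff N (suc k)        ≡⟨ -‿inverseʳ _ ⟩
      0#                                               ∎))
      where
      open ≡-Reasoning
      c : A
      c = fromℕ (suc k)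
      convolutions-agree : convolution (coeff M) (λ j → powerSum j M) (suc k) ≡ convolution (coeff N) (λ j → powerSum j N) (suc k)
      convolutions-agree = convolution-cong (suc k) (λ i i<k → rec i<k (ℕ.<-trans i<k k<K))
                                            (λ j 0<j j≤k → same-powerSums j 0<j (ℕ.≤-<-trans j≤k k<K))
      c*coeffs-agree : c * coeff M (suc k) ≡ c * coeff N (suc k)
      c*coeffs-agree = begin
        c * coeff M (suc k)                                 ≡⟨ inverseˡ-unique _ _ (newton-identity M (suc k)) ⟩
        - convolution (coeff M) (λ j → powerSum j M) (suc k) ≡⟨ cong -_ convolutions-agree ⟩
        - convolution (coeff N) (λ j → powerSum j N) (suc k) ≡⟨ inverseˡ-unique _ _ (newton-identity N (suc k)) ⟨
        c * coeff N (suc k)                                 ∎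

  evalDesc : ℕ → (ℕ → A) → A → A
  evalDesc zero    f x = 0#
  evalDesc (suc n) f x = evalDesc n f x * x + f n

  evalDesc-linMulDesc : ∀ n f m x → evalDesc (suc n) (linMulDesc m f) x ≡ (x - m) * evalDesc n f x + f n
  evalDesc-linMulDesc zero    f m x = solve 3 (λ x a m → :0 :* x :+ (a :- m :* :0) := (x :- m) :* :0 :+ a) refl x (f 0) m
  evalDesc-linMulDesc (suc n) f m x = begin
    evalDesc (suc n) f′ x * x + (f (suc n) - m * f n)
      ≡⟨ cong (λ e → e * x + (f (suc n) - m * f n)) (evalDesc-linMulDesc n f m x) ⟩
    ((x - m) * evalDesc n f x + f n) * x + (f (suc n) - m * f n)
      ≡⟨ solve 5 (λ x m h a b → ((x :- m) :* h :+ a) :* x :+ (b :- m :* a)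
                                := (x :- m) :* (h :* x :+ a) :+ b) refl x m (evalDesc n f x) (f n) (f (suc n)) ⟩
    (x - m) * (evalDesc n f x * x + f n) + f (suc n) ∎
    where
    open ≡-Reasoning
    f′ : ℕ → A
    f′ = linMulDesc m f

  rootProduct-coeff : ∀ M x → rootProduct M x ≡ evalDesc (suc (length M)) (coeff M) x
  rootProduct-coeff []      x = solve 1 (λ x → :1 := :0 :* x :+ :1) refl x
  rootProduct-coeff (m ∷ M) x = begin
    (x - m) * rootProduct M x                   ≡⟨ cong ((x - m) *_) (rootProduct-coeff M x) ⟩
    (x - m) * e                                 ≡⟨ +-identityʳ _ ⟨
    (x - m) * e + 0#                            ≡⟨ cong ((x - m) * e +_) (coeff-beyond M (suc (length M)) ℕ.≤-refl) ⟨
    (x - m) * e + coeff M (suc (length M))      ≡⟨ evalDesc-linMulDesc (suc (length M)) (coeff M) m x ⟨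
    evalDesc (suc (suc (length M))) (coeff (m ∷ M)) x ∎
    where
    open ≡-Reasoning
    e : A
    e = evalDesc (suc (length M)) (coeff M) x

  evalDesc-sub : ∀ n f g x → evalDesc n (λ i → f i - g i) x ≡ evalDesc n f x - evalDesc n g x
  evalDesc-sub zero    f g x = solve 0 (:0 := :0 :- :0) refl
  evalDesc-sub (suc n) f g x = trans (cong (λ e → e * x + (f n - g n)) (evalDesc-sub n f g x))
    (solve 5 (λ a b x c d → (a :- b) :* x :+ (c :- d) := (a :* x :+ c) :- (b :* x :+ d)) refl (evalDesc n f x) (evalDesc n g x) x (f n) (g n))

  evalDesc-+ : ∀ a b f x → evalDesc (a ℕ.+ b) f x ≡ evalDesc a f x * x ^ b + evalDesc b (f ∘ (a ℕ.+_)) x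
  evalDesc-+ a zero f x =
    trans (cong (λ n → evalDesc n f x) (ℕ.+-identityʳ a)) (solve 1 (λ h → h := h :* :1 :+ :0) refl (evalDesc a f x))
  evalDesc-+ a (suc b) f x = begin
    evalDesc (a ℕ.+ suc b) f x
      ≡⟨ cong (λ n → evalDesc n f x) (ℕ.+-suc a b) ⟩
    evalDesc (a ℕ.+ b) f x * x + f (a ℕ.+ b)
      ≡⟨ cong (λ e → e * x + f (a ℕ.+ b)) (evalDesc-+ a b f x) ⟩
    (evalDesc a f x * x ^ b + evalDesc b (f ∘ (a ℕ.+_)) x) * x + f (a ℕ.+ b)
      ≡⟨ solve 5 (λ h w r x c → (h :* w :+ r) :* x :+ c
                                := h :* (x :* w) :+ (r :* x :+ c)) refl
                 (evalDesc a f x) (x ^ b) (evalDesc b (f ∘ (a ℕ.+_)) x) x (f (a ℕ.+ b)) ⟩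
    evalDesc a f x * x ^ suc b + evalDesc (suc b) (f ∘ (a ℕ.+_)) x ∎
    where open ≡-Reasoning

  evalDesc-zeros : ∀ a f x → (∀ i → i < a → f i ≡ 0#) → evalDesc a f x ≡ 0#
  evalDesc-zeros zero    f x _     = refl
  evalDesc-zeros (suc a) f x zeros =
    trans (cong₂ (λ e c → e * x + c) (evalDesc-zeros a f x (λ i i<a → zeros i (ℕ.m<n⇒m<1+n i<a))) (zeros a ℕ.≤-refl))
          (solve 1 (λ x → :0 :* x :+ :0 := :0) refl x)

  fromTop : ∀ n → (ℕ → A) → Vec A n
  fromTop zero    f = []
  fromTop (suc n) f = f n ∷ fromTop n f

  eval-fromTop : ∀ n f x → eval (fromTop n f) x ≡ evalDesc n f x
  eval-fromTop zero    f x = refl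
  eval-fromTop (suc n) f x = trans (cong (λ e → f n + x * e) (eval-fromTop n f x))
    (solve 3 (λ a x h → a :+ x :* h := h :* x :+ a) refl (f n) x (evalDesc n f x))

  rootProduct-difference : ∀ (M N : List A) d {h} → length M ≡ length N → d ℕ.+ h ≡ suc (length M) →
    (∀ k → k < d → coeff M k ≡ coeff N k) →
    Σ (Vec A h) λ H → ∀ x → eval H x ≡ rootProduct M x - rootProduct N x
  rootProduct-difference M N d {h} same-length d+h≡1+n same-coeffs = fromTop h (D ∘ (d ℕ.+_)) , λ x → begin
    eval (fromTop h (D ∘ (d ℕ.+_))) x
      ≡⟨ eval-fromTop h _ x ⟩
    evalDesc h (D ∘ (d ℕ.+_)) x
      ≡⟨ +-identityˡ _ ⟨
    0# + evalDesc h (D ∘ (d ℕ.+_)) x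
      ≡⟨ cong (_+ evalDesc h (D ∘ (d ℕ.+_)) x) (sym (trans (cong (_* x ^ h) (evalDesc-zeros d D x D≡0)) (zeroˡ (x ^ h)))) ⟩
    evalDesc d D x * x ^ h + evalDesc h (D ∘ (d ℕ.+_)) x
      ≡⟨ evalDesc-+ d h D x ⟨
    evalDesc (d ℕ.+ h) D x
      ≡⟨ cong (λ n → evalDesc n D x) d+h≡1+n ⟩
    evalDesc (suc (length M)) D x
      ≡⟨ evalDesc-sub (suc (length M)) (coeff M) (coeff N) x ⟩
    evalDesc (suc (length M)) (coeff M) x - evalDesc (suc (length M)) (coeff N) x
      ≡⟨ cong₂ _-_ (rootProduct-coeff M x)
                   (trans (rootProduct-coeff N x) (cong (λ n → evalDesc (suc n) (coeff N) x) (sym same-length))) ⟨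
    rootProduct M x - rootProduct N x ∎
    where
    open ≡-Reasoning
    D : ℕ → A
    D k = coeff M k - coeff N k
    D≡0 : ∀ k → k < d → D k ≡ 0#
    D≡0 k k<d = trans (cong (_- coeff N k) (same-coeffs k k<d)) (-‿inverseʳ _)

  module IntegralDomain (1#≢0# : 1# ≢ 0#) (zero-product : ∀ {a b} → a * b ≡ 0# → a ≡ 0# ⊎ b ≡ 0#) where

    rootProduct≡0#⇒∈ : ∀ {y} (rs : List A) → rootProduct rs y ≡ 0# → y ∈ rs
    rootProduct≡0#⇒∈ [] 1≡0 = contradiction 1≡0 1#≢0#
    rootProduct≡0#⇒∈ {y} (r ∷ rs) ≡0 with zero-product ≡0
    ... | inj₁ y-r≡0 = here (x∙y⁻¹≈ε⇒x≈y y r y-r≡0)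
    ... | inj₂ ≡0′   = there (rootProduct≡0#⇒∈ rs ≡0′)

    rootProduct-nonzero : ∀ {y} (rs : Vec A n) → (∀ i → y ≢ lookup rs i) → rootProduct (toList rs) y ≢ 0#
    rootProduct-nonzero [] y∉rs = 1#≢0#
    rootProduct-nonzero (r ∷ rs) y∉rs ≡0 with zero-product ≡0
    ... | inj₁ y-r≡0 = y∉rs zero (x∙y⁻¹≈ε⇒x≈y _ _ y-r≡0)
    ... | inj₂ ≡0′   = rootProduct-nonzero rs (y∉rs ∘ suc) ≡0′

    factor-theorem : ∀ (Q : Vec A (suc m)) (rs : Vec A m) → Injective _≡_ _≡_ (lookup rs) →
                     (∀ i → eval Q (lookup rs i) ≡ 0#) →
                     ∀ x → eval Q x ≡ last Q * rootProduct (toList rs) x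
    factor-theorem (a ∷ []) [] _ _ x = solve 2 (λ a x → a :+ x :* :0 := a :* :1) refl a x
    factor-theorem {suc m} Q (r ∷ rs) inj roots x = begin
      eval Q x
        ≡⟨ remainder-theorem r Q x ⟩
      (x - r) * eval q x + eval Q r
        ≡⟨ cong₂ (λ u v → (x - r) * u + v) (factor-theorem q rs (lookup-injective-tail inj) q-roots x) (roots zero) ⟩
      (x - r) * (last q * rootProduct (toList rs) x) + 0#
        ≡⟨ cong (λ l → (x - r) * (l * rootProduct (toList rs) x) + 0#) (last-quot r Q) ⟩
      (x - r) * (last Q * rootProduct (toList rs) x) + 0#
        ≡⟨ solve 4 (λ x r l w → (x :- r) :* (l :* w) :+ :0
                                := l :* ((x :- r) :* w)) refl x r (last Q) (rootProduct (toList rs) x) ⟩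
      last Q * ((x - r) * rootProduct (toList rs) x) ∎
      where
      open ≡-Reasoning
      q : Vec A (suc m)
      q = quot r Q
      q-roots : ∀ i → eval q (lookup rs i) ≡ 0#
      q-roots i with zero-product (begin
        (lookup rs i - r) * eval q (lookup rs i)
          ≡⟨ +-identityʳ _ ⟨
        (lookup rs i - r) * eval q (lookup rs i) + 0#
          ≡⟨ cong ((lookup rs i - r) * eval q (lookup rs i) +_) (roots zero) ⟨
        (lookup rs i - r) * eval q (lookup rs i) + eval Q r
          ≡⟨ remainder-theorem r Q (lookup rs i) ⟨
        eval Q (lookup rs i)
          ≡⟨ roots (suc i) ⟩
        0#                                              ∎)
      ... | inj₁ rᵢ-r≡0 = contradiction (sym (x∙y⁻¹≈ε⇒x≈y _ _ rᵢ-r≡0)) (lookup-injective-head inj i)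
      ... | inj₂ q[rᵢ]≡0 = q[rᵢ]≡0

    vanishing⇒replicate-0# : ∀ (Q : Vec A n) (ys : Vec A n) → Injective _≡_ _≡_ (lookup ys) →
                             (∀ i → eval Q (lookup ys i) ≡ 0#) → Q ≡ replicate n 0#
    vanishing⇒replicate-0# [] [] _ _ = refl
    vanishing⇒replicate-0# {suc n} Q (y ∷ rs) inj roots = begin
      Q
        ≡⟨ Q≡init∷ʳlast ⟩
      init Q ∷ʳ last Q
        ≡⟨ cong₂ _∷ʳ_ (vanishing⇒replicate-0# (init Q) rs (lookup-injective-tail inj) init-roots) last≡0 ⟩
      replicate n 0# ∷ʳ 0#
        ≡⟨ replicate-∷ʳ n ⟩
      replicate (suc n) 0# ∎
      where
      open ≡-Reasoning
      Q≡init∷ʳlast : Q ≡ init Q ∷ʳ last Q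
      Q≡init∷ʳlast = proj₂ (proj₂ (initLast Q))
      replicate-∷ʳ : ∀ k → replicate k 0# ∷ʳ 0# ≡ replicate (suc k) 0#
      replicate-∷ʳ zero = refl
      replicate-∷ʳ (suc k) = cong (0# ∷_) (replicate-∷ʳ k)
      last≡0 : last Q ≡ 0#
      last≡0 with zero-product (trans (sym (factor-theorem Q rs (lookup-injective-tail inj) (roots ∘ suc) y)) (roots zero))
      ... | inj₁ last≡0 = last≡0
      ... | inj₂ ≡0     = contradiction ≡0 (rootProduct-nonzero rs (lookup-injective-head inj))
      init-roots : ∀ i → eval (init Q) (lookup rs i) ≡ 0#
      init-roots i = begin
        eval (init Q) (lookup rs i)
          ≡⟨ solve 2 (λ e w → e := e :+ :0 :* w) refl _ (lookup rs i ^ n) ⟩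
        eval (init Q) (lookup rs i) + 0# * lookup rs i ^ n
          ≡⟨ cong (λ c → eval (init Q) (lookup rs i) + c * lookup rs i ^ n) last≡0 ⟨
        eval (init Q) (lookup rs i) + last Q * lookup rs i ^ n
          ≡⟨ eval-∷ʳ (init Q) (last Q) (lookup rs i) ⟨
        eval (init Q ∷ʳ last Q) (lookup rs i)
          ≡⟨ cong (λ v → eval v (lookup rs i)) Q≡init∷ʳlast ⟨
        eval Q (lookup rs i)
          ≡⟨ roots (suc i) ⟩
        0# ∎

    eval-injective : ∀ (P Q : Vec A n) (ys : Vec A n) → Injective _≡_ _≡_ (lookup ys) →
                     (∀ i → eval P (lookup ys i) ≡ eval Q (lookup ys i)) → P ≡ Q
    eval-injective P Q ys inj agree = difference≡0⇒≡ P Q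
      (vanishing⇒replicate-0# (zipWith _-_ P Q) ys inj λ i →
        trans (eval-zipWith-sub P Q _) (trans (cong (_- _) (agree i)) (-‿inverseʳ _)))
      where
      difference≡0⇒≡ : ∀ {n} (P Q : Vec A n) → zipWith _-_ P Q ≡ replicate n 0# → P ≡ Q
      difference≡0⇒≡ [] [] _ = refl
      difference≡0⇒≡ (a ∷ P) (b ∷ Q) eq =
        cong₂ _∷_ (x∙y⁻¹≈ε⇒x≈y a b (∷-injectiveˡ eq)) (difference≡0⇒≡ P Q (∷-injectiveʳ eq))

    rootProducts-agree : ∀ (M N : List A) d {h} → length M ≡ length N → d ℕ.+ h ≡ suc (length M) →
                         (∀ k → k < d → coeff M k ≡ coeff N k) →
                         (ys : Vec A h) → Injective _≡_ _≡_ (lookup ys) →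
                         (∀ i → lookup ys i ∈ M) → (∀ i → lookup ys i ∈ N) →
                         ∀ x → rootProduct M x ≡ rootProduct N x
    rootProducts-agree M N d {h} same-length d+h≡1+n same-coeffs ys injective ys∈M ys∈N x =
      x∙y⁻¹≈ε⇒x≈y _ _ (trans (sym (H≗ x)) (trans (cong (λ H → eval H x) H≡0) (eval-replicate-0# h x)))
      where
      H : Vec A h
      H = proj₁ (rootProduct-difference M N d same-length d+h≡1+n same-coeffs)
      H≗ : ∀ x → eval H x ≡ rootProduct M x - rootProduct N x
      H≗ = proj₂ (rootProduct-difference M N d same-length d+h≡1+n same-coeffs)
      H≡0 : H ≡ replicate h 0#
      H≡0 = vanishing⇒replicate-0# H ys injective λ i → begin
        eval H (lookup ys i)
          ≡⟨ H≗ (lookup ys i) ⟩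
        rootProduct M (lookup ys i) - rootProduct N (lookup ys i)
          ≡⟨ cong₂ _-_ (∈⇒rootProduct≡0# (ys∈M i)) (∈⇒rootProduct≡0# (ys∈N i)) ⟩
        0# - 0#
          ≡⟨ -‿inverseʳ 0# ⟩
        0# ∎
        where open ≡-Reasoning

module PrimeField (p : ℕ) .{{_ : NonZero p}} where

  ι : ℕ → Fin p
  ι n = n mod p

  -- ι is a surjective semiring map ℕ → F_p, so each law is transported from ℕ.
  private module Arithmetic where
    open import Algebra.Definitions {A = Fin p} _≡_

    infixl 6 _+_
    infixl 7 _*_
    infix  8 -_

    _+_ _*_ : Op₂ (Fin p)
    _+_ = addF p
    _*_ = mulF p

    -_ : Op₁ (Fin p)
    - a = (p ∸ toℕ a) mod p

    toℕ-ι : ∀ n → toℕ (ι n) ≡ n % p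
    toℕ-ι n = toℕ-fromℕ< _

    ι-toℕ : ∀ a → ι (toℕ a) ≡ a
    ι-toℕ a = toℕ-injective (trans (toℕ-ι _) (m<n⇒m%n≡m (toℕ<n a)))

    ι-homo-+ : ∀ m n → ι (m ℕ.+ n) ≡ ι m + ι n
    ι-homo-+ m n = toℕ-injective (begin
      toℕ (ι (m ℕ.+ n))          ≡⟨ toℕ-ι _ ⟩
      (m ℕ.+ n) % p              ≡⟨ %-distribˡ-+ m n p ⟩
      (m % p ℕ.+ n % p) % p      ≡⟨ cong₂ (λ u v → (u ℕ.+ v) % p) (toℕ-ι m) (toℕ-ι n) ⟨
      (toℕ (ι m) ℕ.+ toℕ (ι n)) % p ≡⟨ toℕ-ι _ ⟨
      toℕ (ι m + ι n)            ∎)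
      where open ≡-Reasoning

    ι-homo-* : ∀ m n → ι (m ℕ.* n) ≡ ι m * ι n
    ι-homo-* m n = toℕ-injective (begin
      toℕ (ι (m ℕ.* n))          ≡⟨ toℕ-ι _ ⟩
      (m ℕ.* n) % p              ≡⟨ %-distribˡ-* m n p ⟩
      (m % p ℕ.* (n % p)) % p    ≡⟨ cong₂ (λ u v → (u ℕ.* v) % p) (toℕ-ι m) (toℕ-ι n) ⟨
      (toℕ (ι m) ℕ.* toℕ (ι n)) % p ≡⟨ toℕ-ι _ ⟨
      toℕ (ι m * ι n)            ∎)
      where open ≡-Reasoning

    ι-+ˡ : ∀ m a → ι m + a ≡ ι (m ℕ.+ toℕ a)
    ι-+ˡ m a = trans (cong (ι m +_) (sym (ι-toℕ a))) (sym (ι-homo-+ m (toℕ a)))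

    ι-+ʳ : ∀ a n → a + ι n ≡ ι (toℕ a ℕ.+ n)
    ι-+ʳ a n = trans (cong (_+ ι n) (sym (ι-toℕ a))) (sym (ι-homo-+ (toℕ a) n))

    ι-*ˡ : ∀ m a → ι m * a ≡ ι (m ℕ.* toℕ a)
    ι-*ˡ m a = trans (cong (ι m *_) (sym (ι-toℕ a))) (sym (ι-homo-* m (toℕ a)))

    ι-*ʳ : ∀ a n → a * ι n ≡ ι (toℕ a ℕ.* n)
    ι-*ʳ a n = trans (cong (_* ι n) (sym (ι-toℕ a))) (sym (ι-homo-* (toℕ a) n))

    +-assoc : Associative _+_
    +-assoc a b c = trans (ι-+ˡ _ c) (trans (cong ι (ℕ.+-assoc (toℕ a) _ _)) (sym (ι-+ʳ a _)))

    *-assoc : Associative _*_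
    *-assoc a b c = trans (ι-*ˡ _ c) (trans (cong ι (ℕ.*-assoc (toℕ a) _ _)) (sym (ι-*ʳ a _)))

    +-comm : Commutative _+_
    +-comm a b = cong ι (ℕ.+-comm (toℕ a) _)

    *-comm : Commutative _*_
    *-comm a b = cong ι (ℕ.*-comm (toℕ a) _)

    +-identityˡ : LeftIdentity (ι 0) _+_
    +-identityˡ a = trans (ι-+ˡ 0 a) (ι-toℕ a)

    *-identityˡ : LeftIdentity (ι 1) _*_
    *-identityˡ a = trans (ι-*ˡ 1 a) (trans (cong ι (ℕ.*-identityˡ _)) (ι-toℕ a))

    *-distribʳ-+ : _*_ DistributesOverʳ _+_
    *-distribʳ-+ a b c = begin
      (b + c) * a                         ≡⟨ ι-*ˡ _ a ⟩
      ι ((toℕ b ℕ.+ toℕ c) ℕ.* toℕ a)       ≡⟨ cong ι (ℕ.*-distribʳ-+ (toℕ a) (toℕ b) _) ⟩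
      ι (toℕ b ℕ.* toℕ a ℕ.+ toℕ c ℕ.* toℕ a) ≡⟨ ι-homo-+ _ _ ⟩
      b * a + c * a                       ∎
      where open ≡-Reasoning

    ι[p]≡0 : ι p ≡ ι 0
    ι[p]≡0 = toℕ-injective (trans (toℕ-ι p) (trans ([m+n]%n≡m%n 0 p) (sym (toℕ-ι 0))))

    +-inverseʳ : RightInverse (ι 0) -_ _+_
    +-inverseʳ a = begin
      a + - a                       ≡⟨ ι-+ʳ a _ ⟩
      ι (toℕ a ℕ.+ (p ∸ toℕ a))     ≡⟨ cong ι (ℕ.m+[n∸m]≡n (ℕ.<⇒≤ (toℕ<n a))) ⟩
      ι p                           ≡⟨ ι[p]≡0 ⟩
      ι 0                           ∎
      where open ≡-Reasoning

    +-*-isCommutativeRing : IsCommutativeRing _≡_ _+_ _*_ -_ (zeroF p) (oneF p)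
    +-*-isCommutativeRing = record
      { isRing = record
        { +-isAbelianGroup = record
          { isGroup = record
            { isMonoid = record
              { isSemigroup = record { isMagma = isMagma _+_ ; assoc = +-assoc }
              ; identity    = comm∧idˡ⇒id +-comm +-identityˡ
              }
            ; inverse = comm∧invʳ⇒inv +-comm +-inverseʳ
            ; ⁻¹-cong = cong -_
            }
          ; comm = +-comm
          }
        ; *-cong     = cong₂ _*_
        ; *-assoc    = *-assoc
        ; *-identity = comm∧idˡ⇒id *-comm *-identityˡ
        ; distrib    = comm∧distrʳ⇒distr (cong₂ _+_) *-comm *-distribʳ-+
        }
      ; *-comm = *-comm
      }


  open Arithmetic using (ι-homo-+; toℕ-ι; ι-+ʳ; +-*-isCommutativeRing)
  open Arithmetic public using (ι-toℕ)
  open Polynomials +-*-isCommutativeRing public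
  open import Algebra.Properties.Semiring.Sum (CommutativeRing.semiring commutativeRing)
    using (∑-distrib-+; *-distribˡ-sum; ∑-permute; sum-cong-≗; sum-replicate-zero)

  open CommutativeRing commutativeRing using (zeroˡ; zeroʳ; +-identityʳ; *-identityʳ; -‿inverseʳ)

  prodLin≡ : ∀ {n} (rs : Vec (Fin p) n) → Defs.prodLin p rs ≡ prodLin rs
  prodLin≡ []       = refl
  prodLin≡ (r ∷ rs) = trans (zipWith-subF _ _) (cong (linMul r) (prodLin≡ rs))
    where
    zipWith-subF : ∀ {n} (xs ys : Vec (Fin p) n) → zipWith (subF p) xs ys ≡ zipWith _-_ xs ys
    zipWith-subF []       []       = refl
    zipWith-subF (x ∷ xs) (y ∷ ys) = cong₂ _∷_ (sym (ι-+ʳ x (p ∸ toℕ y))) (zipWith-subF xs ys)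

  toℕ-0# : toℕ 0# ≡ 0
  toℕ-0# = trans (toℕ-ι 0) (m<n⇒m%n≡m (ℕ.>-nonZero⁻¹ p))

  toℕ≡0⇒≡0# : ∀ {a} → toℕ a ≡ 0 → a ≡ 0#
  toℕ≡0⇒≡0# a≡0 = toℕ-injective (trans a≡0 (sym toℕ-0#))

  fromℕ≡ι : ∀ n → fromℕ n ≡ ι n
  fromℕ≡ι zero    = refl
  fromℕ≡ι (suc n) = trans (fromℕ-suc n) (trans (cong (ι 1 +_) (fromℕ≡ι n)) (sym (ι-homo-+ 1 n)))

  ι-nonzero : ∀ {k} → 0 < k → k < p → ι k ≢ ι 0
  ι-nonzero {k} 0<k k<p ιk≡ι0 = ℕ.<⇒≢ 0<k (sym (begin
    k          ≡⟨ m<n⇒m%n≡m k<p ⟨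
    k % p      ≡⟨ toℕ-ι k ⟨
    toℕ (ι k)  ≡⟨ cong toℕ ιk≡ι0 ⟩
    toℕ (ι 0)  ≡⟨ toℕ-ι 0 ⟩
    0 % p      ≡⟨ m<n⇒m%n≡m (ℕ.<-trans 0<k k<p) ⟩
    0          ∎))
    where open ≡-Reasoning

  ∑-translation-invariant : ∀ (f : Fin p → Fin p) → ∑[ x < p ] f (x + 1#) ≡ ∑[ x < p ] f x
  ∑-translation-invariant f = sym (∑-permute f translation)
    where
    translation : Permutation p p
    translation = permutation (_+ 1#) (_- 1#)
      (λ x → solve 1 (λ x → (x :- :1) :+ :1 := x) refl x)
      (λ x → solve 1 (λ x → (x :+ :1) :- :1 := x) refl x)

  ∑-low-degree-vanishes : ∀ {L} → (∀ l → l < L → ∑[ x < p ] (x ^ l) ≡ 0#) →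
                    ∀ {n} (Q : Vec (Fin p) n) j → n ℕ.+ j ≤ L → ∑[ x < p ] (eval Q x * x ^ j) ≡ 0#
  ∑-low-degree-vanishes S≡0 []      j _     = trans (sum-cong-≗ (λ x → zeroˡ (x ^ j))) (sum-replicate-zero p)
  ∑-low-degree-vanishes S≡0 (a ∷ Q) j n+j≤L = begin
    ∑[ x < p ] ((a + x * eval Q x) * x ^ j)
      ≡⟨ sum-cong-≗ (λ x → solve 4 (λ a x e w → (a :+ x :* e) :* w := a :* w :+ e :* (x :* w)) refl a x (eval Q x) (x ^ j)) ⟩
    ∑[ x < p ] (a * x ^ j + eval Q x * x ^ suc j)
      ≡⟨ ∑-distrib-+ (λ x → a * x ^ j) (λ x → eval Q x * x ^ suc j) ⟩
    ∑[ x < p ] (a * x ^ j) + ∑[ x < p ] (eval Q x * x ^ suc j)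
      ≡⟨ cong₂ _+_ (sym (*-distribˡ-sum a (λ x → x ^ j)))
                   (∑-low-degree-vanishes S≡0 Q (suc j) (ℕ.≤-trans (ℕ.≤-reflexive (ℕ.+-suc _ j)) n+j≤L)) ⟩
    a * ∑[ x < p ] (x ^ j) + 0#
      ≡⟨ cong (λ s → a * s + 0#) (S≡0 j (ℕ.≤-trans (ℕ.s≤s (ℕ.m≤n+m j _)) n+j≤L)) ⟩
    a * 0# + 0#
      ≡⟨ trans (+-identityʳ _) (zeroʳ a) ⟩
    0# ∎
    where open ≡-Reasoning

  module _ (p-prime : Prime p) where

    1<p : 1 < p
    1<p = ℕ.nonTrivial⇒n>1 p {{prime⇒nonTrivial p-prime}}

    1#≢0# : 1# ≢ 0#
    1#≢0# = ι-nonzero (ℕ.s≤s ℕ.z≤n) 1<p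

    toℕ-1# : toℕ 1# ≡ 1
    toℕ-1# = trans (toℕ-ι 1) (m<n⇒m%n≡m 1<p)

    zero-product : ∀ {a b} → a * b ≡ 0# → a ≡ 0# ⊎ b ≡ 0#
    zero-product {a} {b} ab≡0 = Sum.map p∣⇒≡0# p∣⇒≡0# (euclidsLemma (toℕ a) (toℕ b) p-prime p∣ab)
      where
      p∣ab : p ∣ toℕ a ℕ.* toℕ b
      p∣ab = m%n≡0⇒n∣m _ p (trans (sym (toℕ-ι _)) (trans (cong toℕ ab≡0) toℕ-0#))
      p∣⇒≡0# : ∀ {c : Fin p} → p ∣ toℕ c → c ≡ 0#
      p∣⇒≡0# {c} p∣c = toℕ≡0⇒≡0# (trans (sym (m<n⇒m%n≡m (toℕ<n c))) (n∣m⇒m%n≡0 _ p p∣c))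

    fromℕ-regular : ∀ {k x} → 0 < k → k < p → fromℕ k * x ≡ 0# → x ≡ 0#
    fromℕ-regular {k} 0<k k<p kx≡0 with zero-product kx≡0
    ... | inj₁ k≡0 = contradiction (trans (sym (fromℕ≡ι k)) k≡0) (ι-nonzero 0<k k<p)
    ... | inj₂ x≡0 = x≡0

    -- Sum (x + 1)^(k+1) = x^(k+1) + (k+1) x^k + binomialTail k over F_p: translation invariance
    -- cancels the outer terms, and binomialTail k has degree < k.
    powerSum-vanishes : ∀ k → suc k < p → ∑[ x < p ] (x ^ k) ≡ 0#
    powerSum-vanishes = <-rec _ step
      where
      step : ∀ k → (∀ {l} → l < k → suc l < p → ∑[ x < p ] (x ^ l) ≡ 0#) → suc k < p → ∑[ x < p ] (x ^ k) ≡ 0#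
      step k rec k+1<p = fromℕ-regular (ℕ.s≤s ℕ.z≤n) k+1<p (begin
        c * S k                                          ≡⟨ *-distribˡ-sum c (_^ k) ⟩
        ∑[ x < p ] (c * x ^ k)                           ≡⟨ +-identityʳ _ ⟨
        ∑[ x < p ] (c * x ^ k) + 0#                      ≡⟨ cong (∑[ x < p ] (c * x ^ k) +_) ∑R≡0 ⟨
        ∑[ x < p ] (c * x ^ k) + ∑[ x < p ] (eval R x)   ≡⟨ ∑-distrib-+ (λ x → c * x ^ k) (eval R) ⟨
        T                                                ≡⟨ solve 2 (λ t s → t := (t :+ s) :- s) refl T (S (suc k)) ⟩
        T + S (suc k) - S (suc k)                        ≡⟨ cong (_- S (suc k)) T+S≡S ⟩
        S (suc k) - S (suc k)                            ≡⟨ -‿inverseʳ _ ⟩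
        0#                                               ∎)
        where
        open ≡-Reasoning
        S : ℕ → Fin p
        S j = ∑[ x < p ] (x ^ j)
        R : Vec (Fin p) k
        R = binomialTail k
        c T : Fin p
        c = fromℕ (suc k)
        T = ∑[ x < p ] (c * x ^ k + eval R x)
        ∑R≡0 : ∑[ x < p ] (eval R x) ≡ 0#
        ∑R≡0 = trans (sum-cong-≗ (λ x → sym (*-identityʳ (eval R x))))
          (∑-low-degree-vanishes (λ l l<k → rec l<k (ℕ.<-trans (ℕ.s≤s l<k) k+1<p)) R 0 (ℕ.≤-reflexive (ℕ.+-identityʳ k)))
        T+S≡S : T + S (suc k) ≡ S (suc k)
        T+S≡S = begin
          T + S (suc k)
            ≡⟨ ∑-distrib-+ (λ x → c * x ^ k + eval R x) (_^ suc k) ⟨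
          ∑[ x < p ] (c * x ^ k + eval R x + x ^ suc k)
            ≡⟨ sum-cong-≗ (λ x →
                 trans (cong (λ r → c * x ^ k + r + x ^ suc k) (eval-binomialTail k x))
                       (solve 4 (λ c w B X → c :* w :+ (B :- X :- c :* w) :+ X := B) refl c (x ^ k) ((x + 1#) ^ suc k) (x ^ suc k))) ⟩
          ∑[ x < p ] ((x + 1#) ^ suc k)
            ≡⟨ ∑-translation-invariant (_^ suc k) ⟩
          S (suc k) ∎

module Proposition (p : ℕ) .{{_ : NonZero p}} (p-prime : Prime p) where

  open PrimeField p
  open IntegralDomain (1#≢0# p-prime) (zero-product p-prime)
  open CommutativeRing commutativeRing using (*-identityˡ; zeroʳ; +-identityʳ)
  open import Algebra.Properties.Semiring.Sum (CommutativeRing.semiring commutativeRing) using (sum-cong-≗)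

  eval-injective-≤p : ∀ {n} → n ≤ p → (P Q : Vec (Fin p) n) → (∀ x → eval P x ≡ eval Q x) → P ≡ Q
  eval-injective-≤p n≤p P Q P≗Q = let ys , inj = distinct-points n≤p in eval-injective P Q ys inj (P≗Q ∘ lookup ys)

  module _ {d} (p≡1+2d : p ≡ suc (d ℕ.+ d)) (P : Vec (Fin p) (suc d)) (values-sum : valueSum p P ≡ p) where

    value : Fin p → ℕ
    value x = toℕ (eval P x)

    M A : List (Fin p)
    M = replicateEach value id
    A = replicateEach (λ _ → 1) id

    Σvalue≡p : ℕ-Sum.sum value ≡ p
    Σvalue≡p = trans (sym (sum-allFin p value)) values-sum

    |M|≡p : length M ≡ p
    |M|≡p = trans (length-replicateEach value id) Σvalue≡p

    |M|≡|A| : length M ≡ length A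
    |M|≡|A| = trans |M|≡p (sym (trans (length-replicateEach (λ (_ : Fin p) → 1) id) (sum-ones p)))

    d<p : d < p
    d<p = ℕ.≤-trans (ℕ.s≤s (ℕ.m≤m+n d d)) (ℕ.≤-reflexive (sym p≡1+2d))

    d+[2+d]≡1+p : d ℕ.+ (2 ℕ.+ d) ≡ suc p
    d+[2+d]≡1+p = trans (ℕ.+-suc d (suc d)) (cong suc (trans (ℕ.+-suc d d) (sym p≡1+2d)))

    d+[2+d]≡1+|M| : d ℕ.+ (2 ℕ.+ d) ≡ suc (length M)
    d+[2+d]≡1+|M| = trans d+[2+d]≡1+p (cong suc (sym |M|≡p))

    powerSums-agree : ∀ j → 0 < j → j < d → powerSum j M ≡ powerSum j A
    powerSums-agree j _ j<d = begin
      powerSum j M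
        ≡⟨ powerSum-replicateEach j value id ⟩
      ∑[ x < p ] (fromℕ (value x) * x ^ j)
        ≡⟨ sum-cong-≗ (λ x → cong (_* x ^ j) (trans (fromℕ≡ι (value x)) (ι-toℕ (eval P x)))) ⟩
      ∑[ x < p ] (eval P x * x ^ j)
        ≡⟨ ∑-low-degree-vanishes S≡0 P j (ℕ.+-monoʳ-< d j<d) ⟩
      0#
        ≡⟨ S≡0 j (ℕ.<-≤-trans j<d (ℕ.m≤m+n d d)) ⟨
      ∑[ x < p ] (x ^ j)
        ≡⟨ sum-cong-≗ (λ x → *-identityˡ (x ^ j)) ⟨
      ∑[ x < p ] (fromℕ 1 * x ^ j)
        ≡⟨ powerSum-replicateEach j (λ _ → 1) id ⟨
      powerSum j A ∎
      where
      open ≡-Reasoning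
      S≡0 : ∀ l → l < d ℕ.+ d → ∑[ x < p ] (x ^ l) ≡ 0#
      S≡0 l l<2d = powerSum-vanishes p-prime l (ℕ.≤-trans (ℕ.s≤s l<2d) (ℕ.≤-reflexive (sym p≡1+2d)))

    coeffs-agree : ∀ k → k < d → coeff M k ≡ coeff A k
    coeffs-agree = coeff-determined-by-powerSums M A
      (λ 0<k k<d → fromℕ-regular p-prime 0<k (ℕ.<-trans k<d d<p)) powerSums-agree

    roots⇒factorization : DistinctPoints (λ x → eval P x ≡ 0#) d →
      Σ (Fin p) λ c → Σ (Vec (Fin p) d) λ rs →
        (P ≡ map (mulF p c) (Defs.prodLin p rs)) × Injective _≡_ _≡_ (lookup rs) × (∀ i → eval P (lookup rs i) ≡ 0#)
    roots⇒factorization (rs , injective , roots) = last P , rs , P≡c∏ , injective , roots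
      where
      open ≡-Reasoning
      P≡c∏ : P ≡ map (mulF p (last P)) (Defs.prodLin p rs)
      P≡c∏ = eval-injective-≤p d<p P _ λ x → begin
        eval P x
          ≡⟨ factor-theorem P rs injective roots x ⟩
        last P * rootProduct (toList rs) x
          ≡⟨ cong (last P *_) (trans (cong (λ q → eval q x) (prodLin≡ rs)) (eval-prodLin rs x)) ⟨
        last P * eval (Defs.prodLin p rs) x
          ≡⟨ eval-map-* (last P) (Defs.prodLin p rs) x ⟨
        eval (map (mulF p (last P)) (Defs.prodLin p rs)) x ∎

    nonroots⇒P≡1 : DistinctPoints (λ x → eval P x ≢ 0#) (2 ℕ.+ d) → P ≡ 1# ∷ replicate d 0#
    nonroots⇒P≡1 (ys , injective , nonroots) = eval-injective-≤p d<p P _ λ x → begin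
      eval P x
        ≡⟨ toℕ-injective (trans (sum≡n⇒all-one value value≢0 Σvalue≡p x) (sym (toℕ-1# p-prime))) ⟩
      1#
        ≡⟨ +-identityʳ 1# ⟨
      1# + 0#
        ≡⟨ cong (1# +_) (zeroʳ x) ⟨
      1# + x * 0#
        ≡⟨ cong (λ e → 1# + x * e) (eval-replicate-0# d x) ⟨
      eval (1# ∷ replicate d 0#) x ∎
      where
      open ≡-Reasoning
      ∈A : ∀ y → y ∈ A
      ∈A y = ∈-replicateEach⁺ (λ _ → 1) id y (λ ())
      products-agree : ∀ y → rootProduct M y ≡ rootProduct A y
      products-agree = rootProducts-agree M A d |M|≡|A| d+[2+d]≡1+|M| coeffs-agree ys injective
        (λ i → ∈-replicateEach⁺ value id (lookup ys i) (nonroots i ∘ toℕ≡0⇒≡0#)) (∈A ∘ lookup ys)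
      value≢0 : ∀ y → value y ≢ 0
      value≢0 y =
        let y∈M = rootProduct≡0#⇒∈ M (trans (products-agree y) (∈⇒rootProduct≡0# (∈A y)))
            _ , value≢0 , y≡z = ∈-replicateEach⁻ value id y∈M
        in subst (λ z → value z ≢ 0) (sym y≡z) value≢0

    factorization : 0 < d → toℕ (last P) ≢ 0 →
      Σ (Fin p) λ c → Σ (Vec (Fin p) d) λ rs →
        (P ≡ map (mulF p c) (Defs.prodLin p rs)) × Injective _≡_ _≡_ (lookup rs) × (∀ i → eval P (lookup rs i) ≡ 0#)
    factorization 0<d last≢0 with pigeonhole (λ x → toSum (eval P x Fin.≟ 0#)) d (2 ℕ.+ d) d+[2+d]≡1+p
    ... | inj₁ roots    = roots⇒factorization roots
    ... | inj₂ nonroots = contradiction (trans (cong (toℕ ∘ last) (nonroots⇒P≡1 nonroots)) last≡0) last≢0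
      where
      last≡0 : toℕ (last (1# ∷ replicate d 0#)) ≡ 0
      last≡0 = trans (cong toℕ (last-∷-replicate 0<d 1# 0#)) toℕ-0#

odd⇒≡1+2[n∸1]/2 : ∀ n → ¬ (2 ∣ n) → n ≡ suc ((n ∸ 1) / 2 ℕ.+ (n ∸ 1) / 2)
odd⇒≡1+2[n∸1]/2 n odd = begin
  n                                     ≡⟨ n≡1+[n/2]*2 ⟩
  suc (n / 2 ℕ.* 2)                     ≡⟨ cong suc (ℕ.*-comm (n / 2) 2) ⟩
  suc (n / 2 ℕ.+ (n / 2 ℕ.+ 0))         ≡⟨ cong (λ h → suc (n / 2 ℕ.+ h)) (ℕ.+-identityʳ (n / 2)) ⟩
  suc (n / 2 ℕ.+ n / 2)                 ≡⟨ cong (λ h → suc (h ℕ.+ h)) [n∸1]/2≡n/2 ⟨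
  suc ((n ∸ 1) / 2 ℕ.+ (n ∸ 1) / 2)     ∎
  where
  open ≡-Reasoning
  n%2≡1 : n % 2 ≡ 1
  n%2≡1 with n % 2 | m%n<n n 2 | m%n≡0⇒n∣m n 2
  ... | zero        | _                    | 2∣n = contradiction (2∣n refl) odd
  ... | suc zero    | _                    | _   = refl
  ... | suc (suc _) | ℕ.s≤s (ℕ.s≤s ())     | _
  n≡1+[n/2]*2 : n ≡ suc (n / 2 ℕ.* 2)
  n≡1+[n/2]*2 = trans (m≡m%n+[m/n]*n n 2) (cong (ℕ._+ n / 2 ℕ.* 2) n%2≡1)
  [n∸1]/2≡n/2 : (n ∸ 1) / 2 ≡ n / 2
  [n∸1]/2≡n/2 = trans (cong (λ m → (m ∸ 1) / 2) n≡1+[n/2]*2) (m*n/n≡m (n / 2) 2)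

open Defs using (eval; prodLin)

proposition3p1 : (p : ℕ) .{{_ : NonZero p}} → Prime p → ¬ (2 ∣ p) →
    (P : Vec (Fin p) (suc ((p ∸ 1) / 2))) → toℕ (last P) ≢ 0 →
    valueSum p P ≡ p →
    Σ (Fin p) λ c → Σ (Vec (Fin p) ((p ∸ 1) / 2)) λ rs →
      (P ≡ map (mulF p c) (prodLin p rs)) ×
      Injective _≡_ _≡_ (lookup rs) ×
      (∀ i → eval p P (lookup rs i) ≡ zeroF p)
proposition3p1 p p-prime odd P last≢0 values-sum =
  Proposition.factorization p p-prime p≡1+2d P values-sum 0<d last≢0
  where
  p≡1+2d : p ≡ suc ((p ∸ 1) / 2 ℕ.+ (p ∸ 1) / 2)
  p≡1+2d = odd⇒≡1+2[n∸1]/2 p odd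
  0<d : 0 < (p ∸ 1) / 2
  0<d with (p ∸ 1) / 2 | p≡1+2d
  ... | zero  | p≡1 = contradiction (subst Prime p≡1 p-prime) ¬prime[1]
  ... | suc _ | _   = ℕ.s≤s ℕ.z≤n
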